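{- Let $\mathcal{C}^{\mathbf{pre}}_{\mathbf{par}}$ be the class of all prestandard partitions and $\mathcal{C}^{\mathbf{sta}}_{\mathbf{par}}$ the class of all standard partitions. Then $\mathtt{Log}(\mathcal{C}^{\mathbf{pre}}_{\mathbf{par}})=\mathtt{Log}(\mathcal{C}^{\mathbf{sta}}_{\mathbf{par}})$. Here: - a partition is a frame in which every $R(\alpha)$ is reflexive, symmetric and transitive; - it is prestandard if $R(\alpha\cup\beta)\subseteq R(\alpha)\cap R(\beta)$ for all groups $\alpha,\beta$; - it is standard if $R(\alpha\cup\beta)=R(\alpha)\cap R(\beta)$ for all groups $\alpha,\beta$.
   Context: **Language.** Let $\mathbf{At}$ be a countably infinite set of atoms and let $\mathbf{Ag}$ be a finite set of agents. A group is a nonempty subset of $\mathbf{Ag}$. Formulas are generated by $$A ::= p \mid (A\rightarrow A) \mid \top \mid \bot \mid (A\vee A) \mid (A\wedge A) \mid [\alpha]A \mid \langle\alpha\rangle A.$$ **Frames.** A frame is a triple $(W,\leq,R)$ where $W$ is a nonempty set, $\leq$ is a preorder on $W$, and $R$ assigns to each group $\alpha$ a binary relation $R(\alpha)$ on $W$. For binary relations $S,T$, write $s\,(S\circ T)\,t$ iff there is $u$ with $sSu$ and $uTt$. Write $\geq$ for the converse of $\leq$. **Models and satisfaction.** A valuation is a map $V:\mathbf{At}\to\wp(W)$ with each $V(p)$ upward closed under $\leq$. Satisfaction in a model $(W,\leq,R,V)$ is defined as follows: - $s\models p$ iff $s\in V(p)$; - $s\models A\rightarrow B$ iff for all $t\geq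 s$, either $t\not\models A$ or $t\models B$; - $s\models\top$, and $s\not\models\bot$; - $\vee$ and $\wedge$ are interpreted pointwise; - $s\models[\alpha]A$ iff for all $t$ with $s\,(\leq\circ R(\alpha))\,t$, $t\models A$; - $s\models\langle\alpha\rangle A$ iff there is $t$ with $s\,(\geq\circ R(\alpha))\,t$ and $t\models A$. A formula is valid in a frame if it is satisfied at every state of every model based on that frame. For a class $\mathcal{C}$ of frames, $\mathtt{Log}(\mathcal{C})$ is the set of formulas valid in every frame in $\mathcal{C}$. -}

module Defs where

open import Level using (0ℓ)
open import Data.Nat using (ℕ)
open import Data.Fin.Subset using (Subset; Nonempty; _∪_)
open import Data.Product using (Σ; ∃; _×_; _,_)
open import Data.Sum using (_⊎_)
open import Data.Empty using (⊥)
open import Data.Unit using (⊤)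
open import Function.Bundles using (_⇔_)

Group : ℕ → Set
Group n = Σ (Subset n) Nonempty

data Form (n : ℕ) : Set where
  atom : ℕ → Form n
  _⇒_ : Form n → Form n → Form n
  ⊤′ ⊥′ : Form n
  _∨′_ _∧′_ : Form n → Form n → Form n
  box dia : Group n → Form n → Form n

-- A frame (W, ≤, R).  R is given on all subsets of agents, but only its
-- values on groups (nonempty subsets) are ever used or constrained.
record Frame (n : ℕ) : Set₁ where
  field
    W      : Set
    inhab  : W
    _≼_    : W → W → Set
    ≼-refl : ∀ {s} → s ≼ s
    ≼-trans : ∀ {s t u} → s ≼ t → t ≼ u → s ≼ u
    R      : Subset n → W → W → Set

record Valuation {n : ℕ} (F : Frame n) : Set₁ where
  open Frame F
  field
    V   : ℕ → W → Set
    up  : ∀ p {s t} → s ≼ t → V p s → V p t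

module _ {n : ℕ} (F : Frame n) (v : Valuation F) where
  open Frame F
  open Valuation v

  _⊨_ : W → Form n → Set
  s ⊨ atom p = V p s
  s ⊨ (A ⇒ B) = ∀ t → s ≼ t → t ⊨ A → t ⊨ B
  s ⊨ ⊤′ = ⊤
  s ⊨ ⊥′ = ⊥
  s ⊨ (A ∨′ B) = (s ⊨ A) ⊎ (s ⊨ B)
  s ⊨ (A ∧′ B) = (s ⊨ A) × (s ⊨ B)
  -- s (≤ ∘ R α) t : ∃ u, s ≤ u and u R(α) t
  s ⊨ box (α , _) A = ∀ u t → s ≼ u → R α u t → t ⊨ A
  -- s (≥ ∘ R α) t : ∃ u, u ≤ s and u R(α) t
  s ⊨ dia (α , _) A = ∃ λ u → ∃ λ t → u ≼ s × R α u t × t ⊨ A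

ValidIn : {n : ℕ} → Form n → Frame n → Set₁
ValidIn A F = ∀ (v : Valuation F) (s : Frame.W F) → _⊨_ F v s A

IsPartition : {n : ℕ} → Frame n → Set
IsPartition {n} F = ∀ (α : Group n) →
  let a = Data.Product.proj₁ α in
    (∀ s → R a s s)
  × (∀ s t → R a s t → R a t s)
  × (∀ s t u → R a s t → R a t u → R a s u)
  where open Frame F

IsPrestandard : {n : ℕ} → Frame n → Set
IsPrestandard {n} F = IsPartition F ×
  (∀ (α β : Group n) → let a = Data.Product.proj₁ α ; b = Data.Product.proj₁ β in
     ∀ s t → R (a ∪ b) s t → R a s t × R b s t)
  where open Frame F

IsStandard : {n : ℕ} → Frame n → Set
IsStandard {n} F = IsPartition F ×
  (∀ (α β : Group n) → let a = Data.Product.proj₁ α ; b = Data.Product.proj₁ β in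
     ∀ s t → R (a ∪ b) s t ⇔ (R a s t × R b s t))
  where open Frame F

InLog : {n : ℕ} → (Frame n → Set) → Form n → Set₁
InLog {n} C A = ∀ (F : Frame n) → C F → ValidIn A F

-- Every standard partition is prestandard, so Log(pre) ⊆ Log(sta).  Conversely a
-- prestandard partition F is the image of a standard one under a surjective bounded
-- morphism, which reflects validity: unravel F into paths s₀ α₁ s₁ … αₖ sₖ with
-- sᵢ₋₁ R(αᵢ) sᵢ, and let two paths from the same root be R′(α)-related iff, past
-- their common stem, every step is labelled by a group containing α.  Containing
-- α ∪ β is containing both α and β, so R′ is standard; and since R is antitone in
-- the group, the endpoint of an α-labelled walk stays in the R(α)-class of its start.
module Submission where

open import Defs
open import Level using (Level; _⊔_; 0ℓ)
open import Data.Nat using (ℕ)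
open import Data.Product using (_×_; ∃; _,_; proj₁; proj₂)
open import Data.Sum using (inj₁; inj₂)
open import Data.Unit using (⊤; tt)
open import Data.List using (List; []; _∷_; _++_)
open import Data.List.Relation.Unary.All as All using (All; []; _∷_)
open import Data.Fin.Subset using (Subset; _⊆_; _∪_)
open import Data.Fin.Subset.Properties using (⊆-refl; ⊆-trans; ⊆-antisym; p⊆p∪q; q⊆p∪q; x∈p∪q⁻)
open import Function.Bundles using (_⇔_; mk⇔; Equivalence)
open import Relation.Binary.PropositionalEquality using (_≡_; refl; sym; trans; subst)
open import Relation.Unary using (Pred; _∩_)
import Relation.Unary as Unary

open Equivalence using (to; from)

∪-lub : ∀ {n} {a b c : Subset n} → a ⊆ c → b ⊆ c → a ∪ b ⊆ c
∪-lub {a = a} {b} a⊆c b⊆c x∈a∪b with x∈p∪q⁻ a b x∈a∪b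
... | inj₁ x∈a = a⊆c x∈a
... | inj₂ x∈b = b⊆c x∈b

⊆⇒∪≡ : ∀ {n} {a b : Subset n} → a ⊆ b → a ∪ b ≡ b
⊆⇒∪≡ {a = a} {b} a⊆b = ⊆-antisym (∪-lub a⊆b ⊆-refl) (q⊆p∪q a b)

module _ {a ℓ : Level} {A : Set a} where

  data CommonStem (P : Pred A ℓ) : List A → List A → Set (a ⊔ ℓ) where
    fork : ∀ {xs ys} → All P xs → All P ys → CommonStem P xs ys
    _∷_  : ∀ x {xs ys} → CommonStem P xs ys → CommonStem P (x ∷ xs) (x ∷ ys)

  module _ {P : Pred A ℓ} where

    CommonStem-refl : ∀ xs → CommonStem P xs xs
    CommonStem-refl []       = fork [] []
    CommonStem-refl (x ∷ xs) = x ∷ CommonStem-refl xs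

    CommonStem-sym : ∀ {xs ys} → CommonStem P xs ys → CommonStem P ys xs
    CommonStem-sym (fork pxs pys) = fork pys pxs
    CommonStem-sym (x ∷ s)        = x ∷ CommonStem-sym s

    All-CommonStem : ∀ {xs ys} → All P xs → CommonStem P xs ys → All P ys
    All-CommonStem _          (fork _ pys) = pys
    All-CommonStem (px ∷ pxs) (x ∷ s)      = px ∷ All-CommonStem pxs s

    CommonStem-trans : ∀ {xs ys zs} → CommonStem P xs ys → CommonStem P ys zs → CommonStem P xs zs
    CommonStem-trans (fork pxs pys) t = fork pxs (All-CommonStem pys t)
    CommonStem-trans (x ∷ s) (fork pys pzs) = fork (All-CommonStem pys (CommonStem-sym (x ∷ s))) pzs
    CommonStem-trans (x ∷ s) (.x ∷ t)       = x ∷ CommonStem-trans s t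

    CommonStem-++ : ∀ xs {ys} → All P ys → CommonStem P xs (xs ++ ys)
    CommonStem-++ []       pys = fork [] pys
    CommonStem-++ (x ∷ xs) pys = x ∷ CommonStem-++ xs pys

  CommonStem-map : ∀ {P Q : Pred A ℓ} → P Unary.⊆ Q → ∀ {xs ys} → CommonStem P xs ys → CommonStem Q xs ys
  CommonStem-map P⊆Q (fork pxs pys) = fork (All.map P⊆Q pxs) (All.map P⊆Q pys)
  CommonStem-map P⊆Q (x ∷ s)        = x ∷ CommonStem-map P⊆Q s

  CommonStem-∩ : ∀ {P Q : Pred A ℓ} {xs ys} →
                 CommonStem P xs ys → CommonStem Q xs ys → CommonStem (P ∩ Q) xs ys
  CommonStem-∩ (fork pxs pys) (fork qxs qys) = fork (All.zip (pxs , qxs)) (All.zip (pys , qys))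
  CommonStem-∩ (fork (px ∷ pxs) (_ ∷ pys)) (x ∷ t) = x ∷ CommonStem-∩ (fork pxs pys) t
  CommonStem-∩ (x ∷ s) (fork (qx ∷ qxs) (_ ∷ qys)) = x ∷ CommonStem-∩ s (fork qxs qys)
  CommonStem-∩ (x ∷ s) (.x ∷ t)                    = x ∷ CommonStem-∩ s t

standard⇒prestandard : ∀ {n} {F : Frame n} → IsStandard F → IsPrestandard F
standard⇒prestandard (part , ∪⇔∩) = part , λ α β s t → to (∪⇔∩ α β s t)

module _ {n : ℕ} (G F : Frame n) where
  private
    module G = Frame G
    module F = Frame F

  record IsBoundedMorphism (f : G.W → F.W) : Set where
    field
      ≼-forth : ∀ {x y} → x G.≼ y → f x F.≼ f y
      ≼-back  : ∀ {x t} → f x F.≼ t → ∃ λ y → x G.≼ y × f y ≡ t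
      ≽-back  : ∀ {x t} → t F.≼ f x → ∃ λ y → y G.≼ x × f y ≡ t
      R-forth : ∀ (α : Group n) {x y} → G.R (proj₁ α) x y → F.R (proj₁ α) (f x) (f y)
      R-back  : ∀ (α : Group n) {x t} → F.R (proj₁ α) (f x) t → ∃ λ y → G.R (proj₁ α) x y × f y ≡ t

  module _ {f : G.W → F.W} (morphism : IsBoundedMorphism f) (v : Valuation F) where
    open IsBoundedMorphism morphism
    open Valuation v

    pullback : Valuation G
    pullback = record { V = λ p x → V p (f x) ; up = λ p x≼y → up p (≼-forth x≼y) }

    private
      ⊨-≡ : ∀ A {s t} → s ≡ t → _⊨_ F v s A → _⊨_ F v t A
      ⊨-≡ A = subst (λ s → _⊨_ F v s A)

    truth-preserved : ∀ A x → _⊨_ G pullback x A ⇔ _⊨_ F v (f x) A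
    truth-preserved (atom p) x = mk⇔ (λ h → h) (λ h → h)
    truth-preserved ⊤′       x = mk⇔ (λ h → h) (λ h → h)
    truth-preserved ⊥′       x = mk⇔ (λ h → h) (λ h → h)
    truth-preserved (A ∨′ B) x = mk⇔
      (λ { (inj₁ a) → inj₁ (to (truth-preserved A x) a) ; (inj₂ b) → inj₂ (to (truth-preserved B x) b) })
      (λ { (inj₁ a) → inj₁ (from (truth-preserved A x) a) ; (inj₂ b) → inj₂ (from (truth-preserved B x) b) })
    truth-preserved (A ∧′ B) x = mk⇔
      (λ (a , b) → to (truth-preserved A x) a , to (truth-preserved B x) b)
      (λ (a , b) → from (truth-preserved A x) a , from (truth-preserved B x) b)
    truth-preserved (A ⇒ B) x = mk⇔
      (λ h t x≼t a → let y , x≼y , fy≡t = ≼-back x≼t in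
        ⊨-≡ B fy≡t (to (truth-preserved B y) (h y x≼y (from (truth-preserved A y) (⊨-≡ A (sym fy≡t) a)))))
      (λ h y x≼y a → from (truth-preserved B y) (h (f y) (≼-forth x≼y) (to (truth-preserved A y) a)))
    truth-preserved (box α A) x = mk⇔
      (λ h u t x≼u uRt → let u′ , x≼u′ , fu′≡u = ≼-back x≼u
                             y , u′Ry , fy≡t = R-back α (subst (λ w → F.R (proj₁ α) w t) (sym fu′≡u) uRt) in
        ⊨-≡ A fy≡t (to (truth-preserved A y) (h u′ y x≼u′ u′Ry)))
      (λ h u y x≼u uRy → from (truth-preserved A y) (h (f u) (f y) (≼-forth x≼u) (R-forth α uRy)))
    truth-preserved (dia α A) x = mk⇔
      (λ (u , y , u≼x , uRy , a) → f u , f y , ≼-forth u≼x , R-forth α uRy , to (truth-preserved A y) a)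
      (λ (u , t , u≼x , uRt , a) → let u′ , u′≼x , fu′≡u = ≽-back u≼x
                                       y , u′Ry , fy≡t = R-back α (subst (λ w → F.R (proj₁ α) w t) (sym fu′≡u) uRt) in
        u′ , y , u′≼x , u′Ry , from (truth-preserved A y) (⊨-≡ A (sym fy≡t) a))

  valid-reflected : ∀ {f : G.W → F.W} → IsBoundedMorphism f → (∀ t → ∃ λ x → f x ≡ t) →
                    ∀ A → ValidIn A G → ValidIn A F
  valid-reflected morphism surjective A valid v t with surjective t
  ... | x , refl = to (truth-preserved morphism v A x) (valid (pullback morphism v) x)

module Unravelling {n : ℕ} (F : Frame n) where
  open Frame F

  Step : Set
  Step = Group n × W

  Walk : W → List Step → Set
  Walk r []             = ⊤
  Walk r ((β , t) ∷ ps) = R (proj₁ β) r t × Walk t ps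

  end : W → List Step → W
  end r []             = r
  end r ((β , t) ∷ ps) = end t ps

  Walk-snoc : ∀ {r} ps (β : Group n) {t} → Walk r ps → R (proj₁ β) (end r ps) t → Walk r (ps ++ (β , t) ∷ [])
  Walk-snoc []             β _           rt = rt , tt
  Walk-snoc ((γ , s) ∷ ps) β (rs , walk) rt = rs , Walk-snoc ps β walk rt

  end-snoc : ∀ r ps (st : Step) → end r (ps ++ st ∷ []) ≡ proj₂ st
  end-snoc r []             st = refl
  end-snoc r ((β , s) ∷ ps) st = end-snoc s ps st

  record Path : Set where
    constructor path
    field
      root  : W
      steps : List Step
      walk  : Walk root steps

  open Path

  endpoint : Path → W
  endpoint x = end (root x) (steps x)

  Labelled : Subset n → Pred Step 0ℓ
  Labelled a st = a ⊆ proj₁ (proj₁ st)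

  Labelled-antitone : ∀ {a b} → a ⊆ b → ∀ {st} → Labelled b st → Labelled a st
  Labelled-antitone a⊆b b⊆ = ⊆-trans a⊆b b⊆

  R′ : Subset n → Path → Path → Set
  R′ a x y = root x ≡ root y × CommonStem (Labelled a) (steps x) (steps y)

  unravelling : Frame n
  unravelling = record
    { W = Path ; inhab = path inhab [] tt
    ; _≼_ = λ x y → endpoint x ≼ endpoint y ; ≼-refl = ≼-refl ; ≼-trans = ≼-trans
    ; R = R′ }

  unravelling-standard : IsStandard unravelling
  unravelling-standard = (λ α → refl′ , sym′ , trans′) , λ α β x y → ∪⇔∩ (proj₁ α) (proj₁ β) x y
    where
    refl′ : ∀ {a} x → R′ a x x
    refl′ x = refl , CommonStem-refl (steps x)
    sym′ : ∀ {a} x y → R′ a x y → R′ a y x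
    sym′ x y (r≡ , s) = sym r≡ , CommonStem-sym s
    trans′ : ∀ {a} x y z → R′ a x y → R′ a y z → R′ a x z
    trans′ x y z (r≡ , s) (r≡′ , t) = trans r≡ r≡′ , CommonStem-trans s t
    ∪⇔∩ : ∀ a b x y → R′ (a ∪ b) x y ⇔ (R′ a x y × R′ b x y)
    ∪⇔∩ a b x y = mk⇔
      (λ (r≡ , s) → (r≡ , CommonStem-map (λ {st} → Labelled-antitone (p⊆p∪q b) {st}) s)
                  , (r≡ , CommonStem-map (λ {st} → Labelled-antitone (q⊆p∪q a b) {st}) s))
      (λ ((r≡ , s) , (_ , t)) → r≡ , CommonStem-map (λ {st} → Labelled-∪ st) (CommonStem-∩ s t))
      where
      Labelled-∪ : ∀ st → Labelled a st × Labelled b st → Labelled (a ∪ b) st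
      Labelled-∪ st (a⊆ , b⊆) = ∪-lub a⊆ b⊆

  module _ (prestandard : IsPrestandard F) (α : Group n) where
    private
      a = proj₁ α
      R-refl  = proj₁ (proj₁ prestandard α)
      R-sym   = proj₁ (proj₂ (proj₁ prestandard α))
      R-trans = proj₂ (proj₂ (proj₁ prestandard α))

    R-antitone : ∀ (β : Group n) {s t} → a ⊆ proj₁ β → R (proj₁ β) s t → R a s t
    R-antitone β {s} {t} a⊆b sRt =
      proj₁ (proj₂ prestandard α β s t (subst (λ c → R c s t) (sym (⊆⇒∪≡ a⊆b)) sRt))

    labelled-walk : ∀ {r} ps → Walk r ps → All (Labelled a) ps → R a r (end r ps)
    labelled-walk {r} []             _           []              = R-refl r
    labelled-walk {r} ((β , t) ∷ ps) (rt , walk) (a⊆b ∷ labelled) =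
      R-trans r t (end t ps) (R-antitone β a⊆b rt) (labelled-walk ps walk labelled)

    common-stem-forth : ∀ {r} ps qs → Walk r ps → Walk r qs →
                        CommonStem (Labelled a) ps qs → R a (end r ps) (end r qs)
    common-stem-forth {r} ps qs wp wq (fork lp lq) =
      R-trans (end r ps) r (end r qs) (R-sym r (end r ps) (labelled-walk ps wp lp)) (labelled-walk qs wq lq)
    common-stem-forth ((β , t) ∷ ps) ((β , t) ∷ qs) (_ , wp) (_ , wq) (_ ∷ s) =
      common-stem-forth ps qs wp wq s

  endpoint-morphism : IsPrestandard F → IsBoundedMorphism unravelling F endpoint
  endpoint-morphism prestandard = record
    { ≼-forth = λ x≼y → x≼y
    ; ≼-back  = λ {_} {t} x≼t → path t [] tt , x≼t , refl
    ; ≽-back  = λ {_} {t} t≼x → path t [] tt , t≼x , refl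
    ; R-forth = R-forth
    ; R-back  = R-back
    }
    where
    R-forth : ∀ α {x y} → R′ (proj₁ α) x y → R (proj₁ α) (endpoint x) (endpoint y)
    R-forth α {path r ps wp} {path .r qs wq} (refl , s) = common-stem-forth prestandard α ps qs wp wq s
    R-back : ∀ α {x t} → R (proj₁ α) (endpoint x) t → ∃ λ y → R′ (proj₁ α) x y × endpoint y ≡ t
    R-back α {path r ps wp} {t} rt =
      path r (ps ++ (α , t) ∷ []) (Walk-snoc ps α wp rt) ,
      (refl , CommonStem-++ ps (⊆-refl ∷ [])) ,
      end-snoc r ps (α , t)

  endpoint-surjective : ∀ t → ∃ λ x → endpoint x ≡ t
  endpoint-surjective t = path t [] tt , refl

proposition13 : (n : ℕ) (A : Form n) →
    (InLog IsPrestandard A → InLog IsStandard A) × (InLog IsStandard A → InLog IsPrestandard A)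
proposition13 n A =
  (λ valid F standard → valid F (standard⇒prestandard {F = F} standard)) ,
  (λ valid F prestandard → let open Unravelling F in
     valid-reflected unravelling F (endpoint-morphism prestandard) endpoint-surjective A
       (valid unravelling unravelling-standard))
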